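{- Let $G$ be a weighted graph and let $a,b$ be identical twins in $G$. Let $G'$ be the weighted graph obtained from $G-b$ by changing the weights of $a$ to \[ \beta'(a)=\beta(a)\beta(b),\qquad \alpha'(a)=\alpha(a)\beta(b)+\alpha(a)\alpha(b)(y-1)+\beta(a)\alpha(b), \] all other vertices keeping their weights. Then $q(G)=q(G')$.
   Context: All graphs are finite and may have loops (at most one per vertex) but no multiple edges. The adjacency matrix of a graph is the symmetric $0/1$ matrix over $GF(2)$ whose diagonal entry at $v$ is $1$ iff $v$ is looped; $r(G)$ and $n(G)$ denote its rank and nullity over $GF(2)$ (the empty graph has $r=n=0$). For $S\subseteq V(G)$, $G[S]$ is the induced subgraph. Let $A$ be a commutative ring with unity containing elements $x,y$. A weighted graph is a graph $G$ together with functions $\alpha,\beta:V(G)\to A$, and its weighted interlace polynomial is \[ q(G)=\sum_{S\subseteq V(G)}\Big(\prod_{s\in S}\alpha(s)\Big)\Big(\prod_{v\notin S}\beta(v)\Big)(x-1)^{r(G[S])}(y-1)^{n(G[S])}. \] Two distinct vertices $a,b$ are identical twins if (i) either both are looped and they are adjacent, or both are unlooped and they are not adjacent, and (ii) they have the same neighbors outside $\{a,b\}$. -}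

module Defs where

open import Level using (Level)
open import Data.Bool using (Bool; true; false; not; _∧_; _∨_; _xor_; if_then_else_)
open import Data.Nat using (ℕ; zero; suc; _⊔_; _∸_)
open import Data.Fin using (Fin; punchIn; _≟_)
open import Data.Fin.Subset using (Subset; ∣_∣; inside; outside)
open import Data.Vec using (Vec; []; _∷_; lookup)
open import Data.List using (List; []; _∷_; map; _++_; foldr)
open import Data.Bool.ListAction using (all; any)
open import Data.List.Base using (allFin)
open import Relation.Nullary using (does)
open import Relation.Binary.PropositionalEquality using (_≡_)
open import Algebra.Bundles using (CommutativeRing)

-- A (finite) graph with loops on vertex set Fin n, given by its
-- symmetric 0/1 adjacency matrix (diagonal entry = loop).
record Graph (n : ℕ) : Set where
  field
    adj : Fin n → Fin n → Bool
    adj-sym : ∀ i j → adj i j ≡ adj j i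
open Graph public

subsets : (n : ℕ) → List (Subset n)
subsets zero = [] ∷ []
subsets (suc n) = map (outside ∷_) (subsets n) ++ map (inside ∷_) (subsets n)

mem : ∀ {n} → Subset n → Fin n → Bool
mem S i = lookup S i

subsetB : ∀ {n} → Subset n → Subset n → Bool
subsetB {n} T S = all (λ i → not (mem T i) ∨ mem S i) (allFin n)

nonemptyB : ∀ {n} → Subset n → Bool
nonemptyB {n} T = any (mem T) (allFin n)

rowSum : ∀ {n} → (Fin n → Fin n → Bool) → Subset n → Fin n → Bool
rowSum {n} M T j = foldr (λ i acc → (mem T i ∧ M i j) xor acc) false (allFin n)

-- the rows indexed by T ⊆ S, restricted to the columns in S, are linearly
-- independent over GF(2): no nonempty subfamily sums to the zero vector
independentB : ∀ {n} → (Fin n → Fin n → Bool) → Subset n → Subset n → Bool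
independentB {n} M S T =
  all (λ T' → not (subsetB T' T ∧ nonemptyB T')
              ∨ any (λ j → mem S j ∧ rowSum M T' j) (allFin n))
      (subsets n)

-- rank over GF(2) of the principal submatrix M[S,S]
-- (= maximal size of a linearly independent family of its rows)
rankOn : ∀ {n} → (Fin n → Fin n → Bool) → Subset n → ℕ
rankOn {n} M S =
  foldr (λ T acc → (if subsetB T S ∧ independentB M S T then ∣ T ∣ else 0) ⊔ acc)
        0 (subsets n)

nullityOn : ∀ {n} → (Fin n → Fin n → Bool) → Subset n → ℕ
nullityOn M S = ∣ S ∣ ∸ rankOn M S

r : ∀ {n} → Graph n → Subset n → ℕ
r G S = rankOn (adj G) S

nul : ∀ {n} → Graph n → Subset n → ℕ
nul G S = nullityOn (adj G) S

delete : ∀ {n} → Graph (suc n) → Fin (suc n) → Graph n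
delete G b = record
  { adj = λ i j → adj G (punchIn b i) (punchIn b j)
  ; adj-sym = λ i j → adj-sym G (punchIn b i) (punchIn b j) }

IdenticalTwins : ∀ {n} → Graph n → Fin n → Fin n → Set
IdenticalTwins {n} G a b =
  (a ≡ b → Data.Empty.⊥) ×
  (adj G a a ≡ adj G b b × adj G a b ≡ adj G a a) ×
  (∀ (c : Fin n) → (c ≡ a → Data.Empty.⊥) → (c ≡ b → Data.Empty.⊥) → adj G a c ≡ adj G b c)
  where open import Data.Product using (_×_)
        import Data.Empty

module Interlace {c ℓ : Level} (R : CommutativeRing c ℓ) where
  open CommutativeRing R

  pow : Carrier → ℕ → Carrier
  pow z zero = 1#
  pow z (suc k) = z * pow z k

  weight : ∀ {n} → (Fin n → Carrier) → (Fin n → Carrier) → Subset n → Carrier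
  weight {n} α β S = foldr (λ i acc → (if mem S i then α i else β i) * acc) 1# (allFin n)

  q : Carrier → Carrier → ∀ {n} → Graph n → (Fin n → Carrier) → (Fin n → Carrier) → Carrier
  q x y {n} G α β =
    foldr (λ S acc → weight α β S * pow (x - 1#) (r G S) * pow (y - 1#) (nul G S) + acc)
          0# (subsets n)

  setAt : ∀ {n} → (Fin n → Carrier) → Fin n → Carrier → Fin n → Carrier
  setAt f a' w i = if does (i ≟ a') then w else f i

-- Sort the subsets S ⊆ V(G) by S₀ = S ∖ {a, b}, and write G′ = G − b and
-- ν = n(G′[S₀ + a]).  Since a and b are twins, rows a and b of the adjacency
-- matrix are equal, so removing one of them from a set containing both keeps
-- the rank; and a set avoiding b has the same rank in G and in G′.  Hence
-- G[S₀ + a], G[S₀ + b] and G[S₀ + a + b] all have the rank of G′[S₀ + a],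
-- with nullities ν, ν and ν + 1, while G[S₀] and G′[S₀] agree.  The four
-- terms of q(G) belonging to S₀ therefore collapse to the two terms of q(G′)
-- for S₀ and S₀ + a, with weights β(a)β(b) and α(a)β(b) + α(a)α(b)(y − 1) + β(a)α(b).
-- Ranks are compared through their definition as the largest number of
-- independent rows: independent families are transported along the embedding
-- G − b → G, and past the duplicate row b by trading b for a.

module Submission where

open import Defs
open import Level using (Level)
open import Data.Bool using (Bool; true; false; T; T?; not; _∧_; _∨_; _xor_; if_then_else_)
open import Data.Bool.ListAction using (all; any)
open import Data.Bool.Properties using (T-∧; T-≡; xor-∧-commutativeRing; xor-identityʳ; xor-same)
open import Data.Empty using (⊥-elim)
open import Data.Fin using (Fin; zero; suc; punchIn; punchOut; _≟_)
open import Data.Fin.Permutation using (Permutation′; transpose; _⟨$⟩ʳ_; _⟨$⟩ˡ_; inverseˡ; inverseʳ)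
import Data.Fin.Permutation.Components as PC
open import Data.Fin.Properties using (any?; suc-injective; punchIn-injective; punchOut-injective; punchInᵢ≢i; punchIn-punchOut)
open import Data.Fin.Subset using (Subset; ∣_∣; inside; outside; ⊤)
open import Data.Fin.Subset.Properties using (p⊆q⇒∣p∣≤∣q∣)
open import Data.List using (List; []; _∷_; foldr; allFin; _++_)
import Data.List as List
open import Data.List.Membership.Propositional using (_∈_; lose)
open import Data.List.Membership.Propositional.Properties using (∈-allFin; ∈-map⁺; ∈-++⁺ˡ; ∈-++⁺ʳ)
import Data.List.Relation.Unary.All as All
open import Data.List.Relation.Unary.All.Properties using (all⁺; all⁻)
open import Data.List.Relation.Unary.Any using (here; there; satisfied)
open import Data.List.Relation.Unary.Any.Properties using (any⁺; any⁻)
open import Data.Nat using (ℕ; zero; suc; _⊔_; _∸_; _≤_; z≤n)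
import Data.Nat.Properties as ℕ
open import Data.Product using (_×_; _,_; proj₁; ∃)
open import Data.Unit using (tt)
open import Data.Vec using ([]; _∷_; insertAt; tabulate)
open import Data.Vec.Properties using (insertAt-lookup; insertAt-punchIn; lookup∘tabulate; lookup-replicate; []=⇒lookup; lookup⇒[]=)
open import Function using (_∘_; _∘′_; flip; _⇔_; mk⇔)
open import Function.Bundles using (module Equivalence)
open import Function.Definitions using (Injective)
open import Relation.Nullary using (Dec; yes; no; ¬_)
open import Relation.Nullary.Decidable using (isYes; toWitness; fromWitness; _×-dec_)
open import Relation.Binary.PropositionalEquality as ≡ using (_≡_; _≢_; _≗_; refl; cong; cong₂) renaming (sym to ≡-sym)
open import Algebra.Bundles using (CommutativeMonoid; CommutativeRing)

open Equivalence using (to; from)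

T-not-∨ : ∀ x {y} → T (not x ∨ y) ⇔ (T x → T y)
T-not-∨ false = mk⇔ (λ _ ()) (λ _ → tt)
T-not-∨ true  = mk⇔ (λ y _ → y) (λ f → f tt)

T-injective : ∀ {x y} → (T x ⇔ T y) → x ≡ y
T-injective {false} {false} _   = refl
T-injective {false} {true}  x⇔y = ⊥-elim (from x⇔y _)
T-injective {true}  {false} x⇔y = ⊥-elim (to x⇔y _)
T-injective {true}  {true}  _   = refl

T-all-allFin : ∀ {n} (p : Fin n → Bool) → T (all p (allFin n)) ⇔ (∀ i → T (p i))
T-all-allFin {n} p = mk⇔ (λ t i → All.lookup (all⁺ p (allFin n) t) (∈-allFin i))
                         (λ f → all⁻ p {allFin n} (All.tabulate λ {i} _ → f i))

T-any-allFin : ∀ {n} (p : Fin n → Bool) → T (any p (allFin n)) ⇔ ∃ (T ∘ p)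
T-any-allFin {n} p = mk⇔ (satisfied ∘ any⁻ p (allFin n)) (λ (i , t) → any⁺ p (lose (∈-allFin i) t))

-- Sums over Fin n

module FinSum {c ℓ} (M : CommutativeMonoid c ℓ) where
  open CommutativeMonoid M using (Carrier; _≈_; _∙_; ε; setoid; trans; ∙-congˡ)
  open import Algebra.Properties.CommutativeMonoid.Sum M public
    using (sum; sum-remove; sum-cong-≋; sum-cong-≗; sum-replicate-zero; sum-permute)
  open import Relation.Binary.Reasoning.Setoid setoid

  foldr-tabulate : ∀ {b} {B : Set b} (h : B → Carrier) {n} (g : Fin n → B) →
                   foldr (λ x acc → h x ∙ acc) ε (List.tabulate g) ≡ sum (h ∘ g)
  foldr-tabulate h {zero}  g = refl
  foldr-tabulate h {suc n} g = cong (h (g zero) ∙_) (foldr-tabulate h (g ∘ suc))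

  sum-zero : ∀ {n} {f : Fin n → Carrier} → (∀ i → f i ≈ ε) → sum f ≈ ε
  sum-zero {n} f≈ε = trans (sum-cong-≋ f≈ε) (sum-replicate-zero n)

  sum-injective : ∀ {m n} (e : Fin m → Fin n) → Injective _≡_ _≡_ e →
                  (f : Fin n → Carrier) → (∀ j → (∀ i → e i ≢ j) → f j ≈ ε) →
                  sum f ≈ sum (f ∘ e)
  sum-injective {zero}          e inj f off = sum-zero (λ j → off j λ ())
  sum-injective {suc m} {zero}  e inj f off with e zero
  ... | ()
  sum-injective {suc m} {suc n} e inj f off = begin
    sum f                                  ≈⟨ sum-remove f ⟩
    f e₀ ∙ sum (f ∘ punchIn e₀)            ≈⟨ ∙-congˡ (sum-injective e′ inj′ (f ∘ punchIn e₀) off′) ⟩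
    f e₀ ∙ sum (f ∘ punchIn e₀ ∘ e′)       ≡⟨ cong (f e₀ ∙_) (sum-cong-≗ (cong f ∘ punchIn-punchOut ∘ e₀≢)) ⟩
    sum (f ∘ e)                            ∎
    where
    e₀ = e zero
    e₀≢ : ∀ i → e₀ ≢ e (suc i)
    e₀≢ i eq with inj eq
    ... | ()
    e′ : Fin m → Fin n
    e′ i = punchOut (e₀≢ i)
    inj′ : Injective _≡_ _≡_ e′
    inj′ {i} {j} eq = suc-injective (inj (punchOut-injective (e₀≢ i) (e₀≢ j) eq))
    off′ : ∀ j → (∀ i → e′ i ≢ j) → f (punchIn e₀ j) ≈ ε
    off′ j miss = off (punchIn e₀ j) λ
      { zero    eq → punchInᵢ≢i e₀ j (≡.sym eq)
      ; (suc i) eq → miss i (punchIn-injective e₀ _ _ (≡.trans (punchIn-punchOut (e₀≢ i)) eq)) }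

module XorSum = FinSum (CommutativeRing.+-commutativeMonoid xor-∧-commutativeRing)
module CountSum = FinSum ℕ.+-0-commutativeMonoid

rowSum≡sum : ∀ {n} (M : Fin n → Fin n → Bool) (U : Subset n) j →
             rowSum M U j ≡ XorSum.sum (λ i → mem U i ∧ M i j)
rowSum≡sum M U j = XorSum.foldr-tabulate (λ i → mem U i ∧ M i j) (λ i → i)

indicator : Bool → ℕ
indicator b = if b then 1 else 0

∣∣≡sum : ∀ {n} (U : Subset n) → ∣ U ∣ ≡ CountSum.sum (indicator ∘ mem U)
∣∣≡sum []            = refl
∣∣≡sum (inside ∷ U)  = cong suc (∣∣≡sum U)
∣∣≡sum (outside ∷ U) = ∣∣≡sum U

-- The rank as the size of a largest independent family of rows

infix 4 _∈ₛ_ _⊆ₛ_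

_∈ₛ_ : ∀ {n} → Fin n → Subset n → Set
i ∈ₛ S = T (mem S i)

_⊆ₛ_ : ∀ {n} → Subset n → Subset n → Set
U ⊆ₛ S = ∀ {i} → i ∈ₛ U → i ∈ₛ S

NonEmpty : ∀ {n} → Subset n → Set
NonEmpty U = ∃ (_∈ₛ U)

RowSumNonzeroOn : ∀ {n} → (Fin n → Fin n → Bool) → Subset n → Subset n → Set
RowSumNonzeroOn M S U = ∃ λ j → j ∈ₛ S × T (rowSum M U j)

Independent : ∀ {n} → (Fin n → Fin n → Bool) → Subset n → Subset n → Set
Independent M S I = ∀ U → U ⊆ₛ I → NonEmpty U → RowSumNonzeroOn M S U

subsets-complete : ∀ {n} (U : Subset n) → U ∈ subsets n
subsets-complete []            = here refl
subsets-complete {suc n} (outside ∷ U) = ∈-++⁺ˡ (∈-map⁺ (outside ∷_) (subsets-complete U))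
subsets-complete {suc n} (inside ∷ U)  =
  ∈-++⁺ʳ (List.map (outside ∷_) (subsets n)) (∈-map⁺ (inside ∷_) (subsets-complete U))

T-subsetB : ∀ {n} (U S : Subset n) → T (subsetB U S) ⇔ U ⊆ₛ S
T-subsetB U S = mk⇔
  (λ t {i} → to (T-not-∨ (mem U i)) (to (T-all-allFin _) t i))
  (λ U⊆S → from (T-all-allFin _) λ i → from (T-not-∨ (mem U i)) U⊆S)

T-nonemptyB : ∀ {n} (U : Subset n) → T (nonemptyB U) ⇔ NonEmpty U
T-nonemptyB U = T-any-allFin (mem U)

T-rowSumNonzeroOn : ∀ {n} (M : Fin n → Fin n → Bool) (S U : Subset n) →
  T (any (λ j → mem S j ∧ rowSum M U j) (allFin n)) ⇔ RowSumNonzeroOn M S U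
T-rowSumNonzeroOn M S U = mk⇔
  (λ t → let j , sr = to (T-any-allFin _) t in j , to T-∧ sr)
  (λ (j , sr) → from (T-any-allFin _) (j , from T-∧ sr))

T-independentB : ∀ {n} (M : Fin n → Fin n → Bool) (S I : Subset n) →
                 T (independentB M S I) ⇔ Independent M S I
T-independentB M S I = mk⇔
  (λ t U (U⊆I : U ⊆ₛ I) ne → to (T-rowSumNonzeroOn M S U)
     (to (T-not-∨ (subsetB U I ∧ nonemptyB U)) (All.lookup (all⁺ _ (subsets _) t) (subsets-complete U))
         (from T-∧ (from (T-subsetB U I) U⊆I , from (T-nonemptyB U) ne))))
  (λ ind → all⁻ _ {subsets _} (All.tabulate λ {U} _ → from (T-not-∨ (subsetB U I ∧ nonemptyB U)) λ t →
     let U⊆I , ne = to T-∧ t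
     in from (T-rowSumNonzeroOn M S U) (ind U (to (T-subsetB U I) U⊆I) (to (T-nonemptyB U) ne))))

module _ {a} {A : Set a} (v : A → ℕ) where

  ≤-foldr-⊔ : ∀ {x xs} → x ∈ xs → v x ≤ foldr (λ y acc → v y ⊔ acc) 0 xs
  ≤-foldr-⊔ {xs = y ∷ ys} (here refl) = ℕ.m≤m⊔n (v y) _
  ≤-foldr-⊔ {xs = y ∷ ys} (there x∈) = ℕ.≤-trans (≤-foldr-⊔ x∈) (ℕ.m≤n⊔m (v y) _)

  foldr-⊔-≤ : ∀ {k} xs → (∀ {x} → x ∈ xs → v x ≤ k) → foldr (λ y acc → v y ⊔ acc) 0 xs ≤ k
  foldr-⊔-≤ []       _     = z≤n
  foldr-⊔-≤ (y ∷ ys) bound = ℕ.⊔-lub (bound (here refl)) (foldr-⊔-≤ ys (bound ∘′ there))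

module _ {n} (M : Fin n → Fin n → Bool) (S : Subset n) where

  ∣∣≤rankOn : ∀ I → I ⊆ₛ S → Independent M S I → ∣ I ∣ ≤ rankOn M S
  ∣∣≤rankOn I I⊆S ind
    with ≤-foldr-⊔ (λ J → if subsetB J S ∧ independentB M S J then ∣ J ∣ else 0) (subsets-complete I)
  ... | bound rewrite to T-≡ (from (T-subsetB I S) I⊆S) | to T-≡ (from (T-independentB M S I) ind) = bound

  rankOn-≤ : ∀ {k} → (∀ I → I ⊆ₛ S → Independent M S I → ∣ I ∣ ≤ k) → rankOn M S ≤ k
  rankOn-≤ {k} bound = foldr-⊔-≤ _ (subsets n) λ {I} _ → bound′ I
    where
    bound′ : ∀ I → (if subsetB I S ∧ independentB M S I then ∣ I ∣ else 0) ≤ k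
    bound′ I with subsetB I S in s | independentB M S I in i
    ... | true  | true  = bound I (to (T-subsetB I S) (from T-≡ s)) (to (T-independentB M S I) (from T-≡ i))
    ... | true  | false = z≤n
    ... | false | _     = z≤n

∣∣-mono : ∀ {n} (U S : Subset n) → U ⊆ₛ S → ∣ U ∣ ≤ ∣ S ∣
∣∣-mono U S U⊆S =
  p⊆q⇒∣p∣≤∣q∣ {p = U} {S} λ {i} i∈U → lookup⇒[]= i S (to T-≡ (U⊆S (from T-≡ ([]=⇒lookup i∈U))))

rankOn≤∣∣ : ∀ {n} (M : Fin n → Fin n → Bool) (S : Subset n) → rankOn M S ≤ ∣ S ∣
rankOn≤∣∣ M S = rankOn-≤ M S λ I I⊆S _ → ∣∣-mono I S I⊆S

TransfersIndependence : ∀ {m n} → (Fin m → Fin m → Bool) → Subset m → (Fin n → Fin n → Bool) → Subset n → Set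
TransfersIndependence M S N S′ =
  ∀ I → I ⊆ₛ S → Independent M S I → ∃ λ J → J ⊆ₛ S′ × Independent N S′ J × ∣ I ∣ ≡ ∣ J ∣

transfer⇒rankOn-≤ : ∀ {m n} (M : Fin m → Fin m → Bool) (S : Subset m) (N : Fin n → Fin n → Bool) (S′ : Subset n) →
              TransfersIndependence M S N S′ → rankOn M S ≤ rankOn N S′
transfer⇒rankOn-≤ M S N S′ transfer = rankOn-≤ M S λ I I⊆S ind →
  let J , J⊆S′ , indJ , ∣I∣≡∣J∣ = transfer I I⊆S ind
  in ℕ.≤-trans (ℕ.≤-reflexive ∣I∣≡∣J∣) (∣∣≤rankOn N S′ J J⊆S′ indJ)

-- Rank under relabelling and under deleting a duplicate row

module Reindex {m n} (e : Fin m → Fin n) (e-inj : Injective _≡_ _≡_ e) where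

  InImage : Subset n → Set
  InImage U = ∀ j → j ∈ₛ U → ∃ λ i → e i ≡ j

  outside-image : ∀ U → InImage U → ∀ j → (∀ i → e i ≢ j) → mem U j ≡ false
  outside-image U U⊆e j miss = T-injective (mk⇔ (λ j∈U → let i , ei≡j = U⊆e j j∈U in miss i ei≡j) λ ())

  module _ (U : Subset n) (U′ : Subset m) (U∘e≡U′ : ∀ i → mem U (e i) ≡ mem U′ i) (U⊆e : InImage U) where

    rowSum-reindex : ∀ (M : Fin n → Fin n → Bool) j → rowSum M U (e j) ≡ rowSum (λ i k → M (e i) (e k)) U′ j
    rowSum-reindex M j = begin
      rowSum M U (e j)
        ≡⟨ rowSum≡sum M U (e j) ⟩
      XorSum.sum (λ k → mem U k ∧ M k (e j))
        ≡⟨ XorSum.sum-injective e e-inj _ (λ k → cong (_∧ M k (e j)) ∘ outside-image U U⊆e k) ⟩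
      XorSum.sum (λ i → mem U (e i) ∧ M (e i) (e j))
        ≡⟨ XorSum.sum-cong-≗ (λ i → cong (_∧ M (e i) (e j)) (U∘e≡U′ i)) ⟩
      XorSum.sum (λ i → mem U′ i ∧ M (e i) (e j))
        ≡⟨ rowSum≡sum (λ i k → M (e i) (e k)) U′ j ⟨
      rowSum (λ i k → M (e i) (e k)) U′ j
        ∎
      where open ≡.≡-Reasoning

    ∣∣-reindex : ∣ U ∣ ≡ ∣ U′ ∣
    ∣∣-reindex = begin
      ∣ U ∣
        ≡⟨ ∣∣≡sum U ⟩
      CountSum.sum (indicator ∘ mem U)
        ≡⟨ CountSum.sum-injective e e-inj _ (λ k → cong indicator ∘ outside-image U U⊆e k) ⟩
      CountSum.sum (indicator ∘ mem U ∘ e)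
        ≡⟨ CountSum.sum-cong-≗ (cong indicator ∘ U∘e≡U′) ⟩
      CountSum.sum (indicator ∘ mem U′)
        ≡⟨ ∣∣≡sum U′ ⟨
      ∣ U′ ∣
        ∎
      where open ≡.≡-Reasoning

  preimage : Subset n → Subset m
  preimage U = tabulate (mem U ∘ e)

  mapsTo? : ∀ U j → Dec (∃ λ i → i ∈ₛ U × e i ≡ j)
  mapsTo? U j = any? λ i → T? (mem U i) ×-dec (e i ≟ j)

  image : Subset m → Subset n
  image U = tabulate (isYes ∘ mapsTo? U)

  mem-preimage : ∀ U i → mem (preimage U) i ≡ mem U (e i)
  mem-preimage U = lookup∘tabulate (mem U ∘ e)

  ∈-image⁻ : ∀ U j → j ∈ₛ image U → ∃ λ i → i ∈ₛ U × e i ≡ j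
  ∈-image⁻ U j j∈ = toWitness {a? = mapsTo? U j} (≡.subst T (lookup∘tabulate _ j) j∈)

  mem-image : ∀ U i → mem (image U) (e i) ≡ mem U i
  mem-image U i = T-injective (mk⇔
    (λ ei∈ → let k , k∈U , ek≡ei = ∈-image⁻ U (e i) ei∈ in ≡.subst (T ∘ mem U) (e-inj ek≡ei) k∈U)
    (λ i∈U → ≡.subst T (≡.sym (lookup∘tabulate _ (e i))) (fromWitness {a? = mapsTo? U (e i)} (i , i∈U , refl))))

  image-InImage : ∀ U → InImage (image U)
  image-InImage U j j∈ = let i , _ , eij = ∈-image⁻ U j j∈ in i , eij

  rankOn-reindex : ∀ (M : Fin n → Fin n → Bool) (S : Subset n) (S′ : Subset m) →
                   (∀ i → mem S (e i) ≡ mem S′ i) → InImage S →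
                   rankOn (λ i k → M (e i) (e k)) S′ ≡ rankOn M S
  rankOn-reindex M S S′ S∘e≡S′ S⊆e =
    ℕ.≤-antisym (transfer⇒rankOn-≤ M′ S′ M S forward) (transfer⇒rankOn-≤ M S M′ S′ backward)
    where
    M′ : Fin m → Fin m → Bool
    M′ i k = M (e i) (e k)

    forward : TransfersIndependence M′ S′ M S
    forward J J⊆S′ indJ =
      image J , image⊆S , independent , ≡.sym (∣∣-reindex (image J) J (mem-image J) (image-InImage J))
      where
      image⊆S : image J ⊆ₛ S
      image⊆S {k} k∈ with ∈-image⁻ J k k∈
      ... | i , i∈J , refl = ≡.subst T (≡.sym (S∘e≡S′ i)) (J⊆S′ i∈J)
      independent : Independent M S (image J)
      independent U U⊆ (k , k∈U) with image-InImage J k (U⊆ k∈U)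
      ... | i , refl with indJ (preimage U) preimage⊆J (i , ≡.subst T (≡.sym (mem-preimage U i)) k∈U)
        where
        preimage⊆J : preimage U ⊆ₛ J
        preimage⊆J {i} i∈ = ≡.subst T (mem-image J i) (U⊆ (≡.subst T (mem-preimage U i) i∈))
      ... | j , j∈S′ , nz =
        e j , ≡.subst T (≡.sym (S∘e≡S′ j)) j∈S′ ,
        ≡.subst T (≡.sym (rowSum-reindex U (preimage U) (≡.sym ∘ mem-preimage U) U⊆image M j)) nz
        where
        U⊆image : InImage U
        U⊆image k k∈ = image-InImage J k (U⊆ k∈)

    backward : TransfersIndependence M S M′ S′
    backward I I⊆S indI =
      preimage I , preimage⊆S′ , independent , ∣∣-reindex I (preimage I) (≡.sym ∘ mem-preimage I) (λ k → S⊆e k ∘ I⊆S)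
      where
      preimage⊆S′ : preimage I ⊆ₛ S′
      preimage⊆S′ {i} i∈ = ≡.subst T (S∘e≡S′ i) (I⊆S (≡.subst T (mem-preimage I i) i∈))
      independent : Independent M′ S′ (preimage I)
      independent U U⊆ (i , i∈U) with indI (image U) image⊆I (e i , ≡.subst T (≡.sym (mem-image U i)) i∈U)
        where
        image⊆I : image U ⊆ₛ I
        image⊆I {k} k∈ with ∈-image⁻ U k k∈
        ... | i , i∈U , refl = ≡.subst T (mem-preimage I i) (U⊆ i∈U)
      ... | k , k∈S , nz with S⊆e k k∈S
      ... | j , refl =
        j , ≡.subst T (S∘e≡S′ j) k∈S ,
        ≡.subst T (rowSum-reindex (image U) U (mem-image U) (image-InImage U) M j) nz

module _ {a} {A : Set a} {n} {u v : Fin n} where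

  transpose-invariant : ∀ (f : Fin n → A) → f u ≡ f v → ∀ i → f (PC.transpose u v i) ≡ f i
  transpose-invariant f fu≡fv i with i ≟ u
  ... | yes refl = ≡.sym fu≡fv
  ... | no _ with i ≟ v
  ...   | yes refl = fu≡fv
  ...   | no _     = refl

transpose-matchʳ : ∀ {n} (u v : Fin n) → PC.transpose u v v ≡ u
transpose-matchʳ u v with v ≟ u
... | yes v≡u = v≡u
... | no _ with v ≟ v
...   | yes _   = refl
...   | no v≢v  = ⊥-elim (v≢v refl)

∣∣-permute : ∀ {n} (π : Permutation′ n) (U V : Subset n) →
             (∀ i → mem V (π ⟨$⟩ʳ i) ≡ mem U i) → ∣ V ∣ ≡ ∣ U ∣
∣∣-permute π U V V∘π≡U = begin
  ∣ V ∣                                      ≡⟨ ∣∣≡sum V ⟩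
  CountSum.sum (indicator ∘ mem V)           ≡⟨ CountSum.sum-permute _ π ⟩
  CountSum.sum (indicator ∘ mem V ∘ (π ⟨$⟩ʳ_)) ≡⟨ CountSum.sum-cong-≗ (cong indicator ∘ V∘π≡U) ⟩
  CountSum.sum (indicator ∘ mem U)           ≡⟨ ∣∣≡sum U ⟨
  ∣ U ∣                                      ∎
  where open ≡.≡-Reasoning

module Duplicate {n} (M : Fin n → Fin n → Bool) (M-sym : ∀ i j → M i j ≡ M j i)
                 {a b : Fin n} (a≢b : a ≢ b) (rows : ∀ j → M a j ≡ M b j) where

  π : Permutation′ n
  π = transpose a b

  rowSum-permute : ∀ U V → (∀ i → mem V (π ⟨$⟩ʳ i) ≡ mem U i) → ∀ j → rowSum M V j ≡ rowSum M U j
  rowSum-permute U V V∘π≡U j = begin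
    rowSum M V j
      ≡⟨ rowSum≡sum M V j ⟩
    XorSum.sum (λ k → mem V k ∧ M k j)
      ≡⟨ XorSum.sum-permute _ π ⟩
    XorSum.sum (λ i → mem V (π ⟨$⟩ʳ i) ∧ M (π ⟨$⟩ʳ i) j)
      ≡⟨ XorSum.sum-cong-≗ (λ i → cong₂ _∧_ (V∘π≡U i) (transpose-invariant (λ k → M k j) (rows j) i)) ⟩
    XorSum.sum (λ i → mem U i ∧ M i j)
      ≡⟨ rowSum≡sum M U j ⟨
    rowSum M U j
      ∎
    where open ≡.≡-Reasoning

  rowSum-columns : ∀ U → rowSum M U b ≡ rowSum M U a
  rowSum-columns U = begin
    rowSum M U b                        ≡⟨ rowSum≡sum M U b ⟩
    XorSum.sum (λ i → mem U i ∧ M i b)  ≡⟨ XorSum.sum-cong-≗ (λ i → cong (mem U i ∧_) (column i)) ⟩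
    XorSum.sum (λ i → mem U i ∧ M i a)  ≡⟨ rowSum≡sum M U a ⟨
    rowSum M U a                        ∎
    where
    open ≡.≡-Reasoning
    column : ∀ i → M i b ≡ M i a
    column i = ≡.trans (M-sym i b) (≡.trans (≡.sym (rows i)) (M-sym a i))

  pairing : Fin 2 → Fin n
  pairing zero    = a
  pairing (suc _) = b

  pairing-injective : Injective _≡_ _≡_ pairing
  pairing-injective {zero}        {zero}        _  = refl
  pairing-injective {zero}        {suc zero}    eq = ⊥-elim (a≢b eq)
  pairing-injective {suc zero}    {zero}        eq = ⊥-elim (a≢b (≡.sym eq))
  pairing-injective {suc zero}    {suc zero}    _  = refl

  open Reindex pairing pairing-injective using (image; mem-image; image-InImage; ∈-image⁻; outside-image)

  -- image ⊤ is the subset {a, b}.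
  rowSum-pair : ∀ j → rowSum M (image ⊤) j ≡ false
  rowSum-pair j = begin
    rowSum M (image ⊤) j
      ≡⟨ rowSum≡sum M (image ⊤) j ⟩
    XorSum.sum (λ k → mem (image ⊤) k ∧ M k j)
      ≡⟨ XorSum.sum-injective pairing pairing-injective _
           (λ k → cong (_∧ M k j) ∘ outside-image (image ⊤) (image-InImage ⊤) k) ⟩
    XorSum.sum (λ i → mem (image ⊤) (pairing i) ∧ M (pairing i) j)
      ≡⟨ XorSum.sum-cong-≗ (λ i → cong (_∧ M (pairing i) j) (≡.trans (mem-image ⊤ i) (lookup-replicate i true))) ⟩
    M a j xor (M b j xor false)  ≡⟨ cong (_xor (M b j xor false)) (rows j) ⟩
    M b j xor (M b j xor false)  ≡⟨ cong (M b j xor_) (xor-identityʳ (M b j)) ⟩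
    M b j xor M b j              ≡⟨ xor-same (M b j) ⟩
    false                        ∎
    where open ≡.≡-Reasoning

  pair-dependent : ∀ S I → a ∈ₛ I → b ∈ₛ I → ¬ Independent M S I
  pair-dependent S I a∈I b∈I indI with indI (image ⊤) pair⊆I (a , ≡.subst T (≡.sym (mem-image ⊤ zero)) _)
    where
    pair⊆I : image ⊤ ⊆ₛ I
    pair⊆I {k} k∈ with ∈-image⁻ ⊤ k k∈
    ... | zero  , _ , refl = a∈I
    ... | suc _ , _ , refl = b∈I
  ... | j , _ , nz = ≡.subst T (rowSum-pair j) nz

  module _ (S S⁻ : Subset n) (a∈S : a ∈ₛ S) (S⁻b : mem S⁻ b ≡ false)
           (S⁻≡S : ∀ j → j ≢ b → mem S⁻ j ≡ mem S j) where

    S⁻⊆S : S⁻ ⊆ₛ S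
    S⁻⊆S {j} j∈ with j ≟ b
    ... | yes refl = ⊥-elim (≡.subst T S⁻b j∈)
    ... | no j≢b   = ≡.subst T (S⁻≡S j j≢b) j∈

    a∈S⁻ : a ∈ₛ S⁻
    a∈S⁻ = ≡.subst T (≡.sym (S⁻≡S a a≢b)) a∈S

    -- Column b of M equals column a, and a survives in S⁻.
    nonzeroOn-S⁻ : ∀ U → RowSumNonzeroOn M S U → RowSumNonzeroOn M S⁻ U
    nonzeroOn-S⁻ U (j , j∈S , nz) with j ≟ b
    ... | yes refl = a , a∈S⁻ , ≡.subst T (rowSum-columns U) nz
    ... | no j≢b   = j , ≡.subst T (≡.sym (S⁻≡S j j≢b)) j∈S , nz

    grow : TransfersIndependence M S⁻ M S
    grow J J⊆S⁻ indJ =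
      J , S⁻⊆S ∘ J⊆S⁻ , (λ U U⊆J ne → let j , j∈ , nz = indJ U U⊆J ne in j , S⁻⊆S j∈ , nz) , refl

    shrink : TransfersIndependence M S M S⁻
    shrink I I⊆S indI with mem I b in Ib
    ... | false = I , I⊆S⁻ , (λ U U⊆I ne → nonzeroOn-S⁻ U (indI U U⊆I ne)) , refl
      where
      I⊆S⁻ : I ⊆ₛ S⁻
      I⊆S⁻ {j} j∈ with j ≟ b
      ... | yes refl = ⊥-elim (≡.subst T Ib j∈)
      ... | no j≢b   = ≡.subst T (≡.sym (S⁻≡S j j≢b)) (I⊆S j∈)
    ... | true with mem I a in Ia
    ...   | true  = ⊥-elim (pair-dependent S I (from T-≡ Ia) (from T-≡ Ib) indI)
    ...   | false = J , J⊆S⁻ , independent , ∣∣-permute π J I (λ i → ≡.sym (lookup∘tabulate _ i))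
      where
      -- b ∈ I and a ∉ I: swap b for a
      J : Subset n
      J = tabulate (mem I ∘ (π ⟨$⟩ʳ_))
      S∘π≡S : ∀ i → mem S (π ⟨$⟩ʳ i) ≡ mem S i
      S∘π≡S = transpose-invariant (mem S) (≡.trans (to T-≡ a∈S) (≡.sym (to T-≡ (I⊆S (from T-≡ Ib)))))
      J⊆S⁻ : J ⊆ₛ S⁻
      J⊆S⁻ {j} j∈ with j ≟ b | ≡.subst T (lookup∘tabulate _ j) j∈
      ... | yes refl | a∈I  = ⊥-elim (≡.subst T Ia (≡.subst (T ∘ mem I) (transpose-matchʳ a b) a∈I))
      ... | no j≢b   | πj∈I = ≡.subst T (≡.trans (S∘π≡S j) (≡.sym (S⁻≡S j j≢b))) (I⊆S πj∈I)
      independent : Independent M S⁻ J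
      independent U U⊆J (k , k∈U) =
        let j , j∈S , nz = indI V V⊆I (π ⟨$⟩ʳ k , ≡.subst T (≡.sym (V∘π≡U k)) k∈U)
        in nonzeroOn-S⁻ U (j , j∈S , ≡.subst T (rowSum-permute U V V∘π≡U j) nz)
        where
        V : Subset n
        V = tabulate (mem U ∘ (π ⟨$⟩ˡ_))
        V∘π≡U : ∀ i → mem V (π ⟨$⟩ʳ i) ≡ mem U i
        V∘π≡U i = ≡.trans (lookup∘tabulate _ (π ⟨$⟩ʳ i)) (cong (mem U) (inverseˡ π))
        V⊆I : V ⊆ₛ I
        V⊆I {i} i∈ =
          let πˡi∈J = U⊆J (≡.subst T (lookup∘tabulate _ i) i∈)
          in ≡.subst (T ∘ mem I) (inverseʳ π) (≡.subst T (lookup∘tabulate (mem I ∘ (π ⟨$⟩ʳ_)) (π ⟨$⟩ˡ i)) πˡi∈J)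

    rankOn-duplicate : rankOn M S ≡ rankOn M S⁻
    rankOn-duplicate = ℕ.≤-antisym (transfer⇒rankOn-≤ M S M S⁻ shrink) (transfer⇒rankOn-≤ M S⁻ M S grow)

∣insertAt∣ : ∀ {n} (S : Subset n) i s → ∣ insertAt S i s ∣ ≡ ∣ s ∷ S ∣
∣insertAt∣ S       zero    s       = refl
∣insertAt∣ (t ∷ S) (suc i) s with ∣insertAt∣ S i s
∣insertAt∣ (inside  ∷ S) (suc i) inside  | eq = cong suc eq
∣insertAt∣ (inside  ∷ S) (suc i) outside | eq = cong suc eq
∣insertAt∣ (outside ∷ S) (suc i) s       | eq = eq

mem-insertAt-≢ : ∀ {n} (S : Subset n) i s t {j} → j ≢ i → mem (insertAt S i s) j ≡ mem (insertAt S i t) j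
mem-insertAt-≢ S i s t {j} j≢i = begin
  mem (insertAt S i s) j                         ≡⟨ cong (mem (insertAt S i s)) (punchIn-punchOut i≢j) ⟨
  mem (insertAt S i s) (punchIn i (punchOut i≢j)) ≡⟨ insertAt-punchIn S i s _ ⟩
  mem S (punchOut i≢j)                            ≡⟨ insertAt-punchIn S i t _ ⟨
  mem (insertAt S i t) (punchIn i (punchOut i≢j)) ≡⟨ cong (mem (insertAt S i t)) (punchIn-punchOut i≢j) ⟩
  mem (insertAt S i t) j                          ∎
  where
  open ≡.≡-Reasoning
  i≢j : i ≢ j
  i≢j = j≢i ∘ ≡.sym

insertAt-agree : ∀ {n} {i} {V V′ : Subset n} → (∀ j → j ≢ i → mem V j ≡ mem V′ j) →
                 ∀ b t j → j ≢ punchIn b i → mem (insertAt V b t) j ≡ mem (insertAt V′ b t) j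
insertAt-agree {V = V} {V′} agree b t j j≢ with j ≟ b
... | yes ≡.refl = ≡.trans (insertAt-lookup V b t) (≡.sym (insertAt-lookup V′ b t))
... | no j≢b = begin
  mem (insertAt V b t) j        ≡⟨ cong (mem (insertAt V b t)) (punchIn-punchOut b≢j) ⟨
  mem (insertAt V b t) (punchIn b j′)  ≡⟨ insertAt-punchIn V b t j′ ⟩
  mem V j′                        ≡⟨ agree j′ (j≢ ∘ ≡.trans (≡.sym (punchIn-punchOut b≢j)) ∘ cong (punchIn b)) ⟩
  mem V′ j′                       ≡⟨ insertAt-punchIn V′ b t j′ ⟨
  mem (insertAt V′ b t) (punchIn b j′) ≡⟨ cong (mem (insertAt V′ b t)) (punchIn-punchOut b≢j) ⟩
  mem (insertAt V′ b t) j       ∎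
  where
  open ≡.≡-Reasoning
  b≢j : b ≢ j
  b≢j = j≢b ∘ ≡.sym
  j′ = punchOut b≢j

r-delete : ∀ {n} (G : Graph (suc n)) b (S : Subset n) → r G (insertAt S b outside) ≡ r (delete G b) S
r-delete G b S = ≡.sym (rankOn-reindex (adj G) (insertAt S b outside) S (insertAt-punchIn S b outside) inImage)
  where
  open Reindex (punchIn b) (punchIn-injective b _ _)
  inImage : InImage (insertAt S b outside)
  inImage j j∈ with j ≟ b
  ... | yes refl = ⊥-elim (≡.subst T (insertAt-lookup S b outside) j∈)
  ... | no j≢b   = punchOut (j≢b ∘ ≡.sym) , punchIn-punchOut _

nul-≡ : ∀ {m n} (G : Graph m) (H : Graph n) S S′ →
        ∣ S ∣ ≡ ∣ S′ ∣ → r G S ≡ r H S′ → nul G S ≡ nul H S′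
nul-≡ G H S S′ = cong₂ _∸_

nul-suc : ∀ {m n} (G : Graph m) (H : Graph n) S S′ →
          ∣ S ∣ ≡ suc ∣ S′ ∣ → r G S ≡ r H S′ → nul G S ≡ suc (nul H S′)
nul-suc G H S S′ ∣S∣≡ rG≡rH = ≡.trans (cong₂ _∸_ ∣S∣≡ rG≡rH) (ℕ.+-∸-assoc 1 (rankOn≤∣∣ (adj H) S′))

twins⇒equal-rows : ∀ {n} (G : Graph n) {a b} → IdenticalTwins G a b → ∀ j → adj G a j ≡ adj G b j
twins⇒equal-rows G {a} {b} (_ , (aa≡bb , ab≡aa) , others) j with j ≟ a | j ≟ b
... | yes refl | _        = ≡.sym (≡.trans (adj-sym G b a) ab≡aa)
... | no _     | yes refl = ≡.trans ab≡aa aa≡bb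
... | no j≢a   | no j≢b   = others j j≢a j≢b

-- The weighted interlace polynomial

module WeightedSums {c ℓ} (R : CommutativeRing c ℓ) where
  open CommutativeRing R renaming (refl to ≈-refl)
  open Interlace R
  open import Relation.Binary.Reasoning.Setoid setoid
  open import Algebra.Properties.CommutativeSemigroup +-commutativeSemigroup using (interchange)
  module Product = FinSum *-commutativeMonoid

  setAt-same : ∀ {n} (f : Fin n → Carrier) k w → setAt f k w k ≡ w
  setAt-same f k w with k ≟ k
  ... | yes _  = ≡.refl
  ... | no k≢k = ⊥-elim (k≢k ≡.refl)

  setAt-punchIn : ∀ {n} (f : Fin (suc n) → Carrier) k w i → setAt f k w (punchIn k i) ≡ f (punchIn k i)
  setAt-punchIn f k w i with punchIn k i ≟ k
  ... | yes eq = ⊥-elim (punchInᵢ≢i k i eq)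
  ... | no _   = ≡.refl

  weight≡product : ∀ {n} (α β : Fin n → Carrier) S →
                   weight α β S ≡ Product.sum (λ i → if mem S i then α i else β i)
  weight≡product α β S = Product.foldr-tabulate (λ i → if mem S i then α i else β i) (λ i → i)

  weight-cong : ∀ {n} {α α′ β β′ : Fin n → Carrier} → α ≗ α′ → β ≗ β′ →
                ∀ S → weight α β S ≡ weight α′ β′ S
  weight-cong {α = α} {α′} {β} {β′} α≗α′ β≗β′ S =
    ≡.trans (weight≡product α β S)
      (≡.trans (Product.sum-cong-≗ λ i → cong₂ (if mem S i then_else_) (α≗α′ i) (β≗β′ i))
               (≡.sym (weight≡product α′ β′ S)))

  weight-insertAt : ∀ {n} (α β : Fin (suc n) → Carrier) S i s →
    weight α β (insertAt S i s) ≈ (if s then α i else β i) * weight (α ∘ punchIn i) (β ∘ punchIn i) S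
  weight-insertAt α β S i s = begin
    weight α β (insertAt S i s)
      ≡⟨ weight≡product α β (insertAt S i s) ⟩
    Product.sum f
      ≈⟨ Product.sum-remove f ⟩
    f i * Product.sum (f ∘ punchIn i)
      ≡⟨ cong₂ _*_ (cong (if_then α i else β i) (insertAt-lookup S i s)) (Product.sum-cong-≗ f∘punchIn) ⟩
    (if s then α i else β i) * Product.sum (λ k → if mem S k then α (punchIn i k) else β (punchIn i k))
      ≡⟨ cong (_ *_) (weight≡product (α ∘ punchIn i) (β ∘ punchIn i) S) ⟨
    (if s then α i else β i) * weight (α ∘ punchIn i) (β ∘ punchIn i) S
      ∎
    where
    f : Fin _ → Carrier
    f k = if mem (insertAt S i s) k then α k else β k
    f∘punchIn : ∀ k → f (punchIn i k) ≡ (if mem S k then α (punchIn i k) else β (punchIn i k))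
    f∘punchIn k = cong (if_then α (punchIn i k) else β (punchIn i k)) (insertAt-punchIn S i s k)

  listSum : ∀ {a} {A : Set a} → (A → Carrier) → List A → Carrier
  listSum F = foldr (λ x acc → F x + acc) 0#

  module _ {a} {A : Set a} where

    listSum-++ : ∀ (F : A → Carrier) xs ys → listSum F (xs ++ ys) ≈ listSum F xs + listSum F ys
    listSum-++ F []       ys = sym (+-identityˡ _)
    listSum-++ F (x ∷ xs) ys = trans (+-congˡ (listSum-++ F xs ys)) (sym (+-assoc _ _ _))

    listSum-+ : ∀ (F G : A → Carrier) xs → listSum (λ x → F x + G x) xs ≈ listSum F xs + listSum G xs
    listSum-+ F G []       = sym (+-identityˡ _)
    listSum-+ F G (x ∷ xs) = trans (+-congˡ (listSum-+ F G xs)) (interchange _ _ _ _)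

    listSum-cong : ∀ {F G : A → Carrier} xs → (∀ x → F x ≈ G x) → listSum F xs ≈ listSum G xs
    listSum-cong []       F≈G = ≈-refl
    listSum-cong (x ∷ xs) F≈G = +-cong (F≈G x) (listSum-cong xs F≈G)

    listSum-map : ∀ {b} {B : Set b} (F : B → Carrier) (g : A → B) xs →
                  listSum F (List.map g xs) ≡ listSum (F ∘ g) xs
    listSum-map F g []       = ≡.refl
    listSum-map F g (x ∷ xs) = cong (F (g x) +_) (listSum-map F g xs)

  ∑ₛ : ∀ n → (Subset n → Carrier) → Carrier
  ∑ₛ n F = listSum F (subsets n)

  ∑ₛ-suc : ∀ {n} F → ∑ₛ (suc n) F ≈ ∑ₛ n (F ∘ (outside ∷_)) + ∑ₛ n (F ∘ (inside ∷_))
  ∑ₛ-suc {n} F = begin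
    ∑ₛ (suc n) F
      ≈⟨ listSum-++ F (List.map (outside ∷_) (subsets n)) _ ⟩
    listSum F (List.map (outside ∷_) (subsets n)) + listSum F (List.map (inside ∷_) (subsets n))
      ≡⟨ cong₂ _+_ (listSum-map F _ (subsets n)) (listSum-map F _ (subsets n)) ⟩
    ∑ₛ n (F ∘ (outside ∷_)) + ∑ₛ n (F ∘ (inside ∷_))
      ∎

  ∑ₛ-insertAt : ∀ {n} (i : Fin (suc n)) F →
    ∑ₛ (suc n) F ≈ ∑ₛ n (λ S → F (insertAt S i outside) + F (insertAt S i inside))
  ∑ₛ-insertAt {n}     zero    F = trans (∑ₛ-suc F) (sym (listSum-+ _ _ (subsets n)))
  ∑ₛ-insertAt {suc n} (suc i) F = begin
    ∑ₛ (suc (suc n)) F                                            ≈⟨ ∑ₛ-suc F ⟩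
    ∑ₛ (suc n) (F ∘ (outside ∷_)) + ∑ₛ (suc n) (F ∘ (inside ∷_))  ≈⟨ +-cong (∑ₛ-insertAt i _) (∑ₛ-insertAt i _) ⟩
    ∑ₛ n (G ∘ (outside ∷_)) + ∑ₛ n (G ∘ (inside ∷_))              ≈⟨ ∑ₛ-suc G ⟨
    ∑ₛ (suc n) G                                                  ∎
    where
    G : Subset (suc n) → Carrier
    G S = F (insertAt S (suc i) outside) + F (insertAt S (suc i) inside)

module TwinReduction {c ℓ} (R : CommutativeRing c ℓ) where
  open CommutativeRing R renaming (refl to ≈-refl)
  open Interlace R
  open WeightedSums R
  open import Relation.Binary.Reasoning.Setoid setoid
  open import Algebra.Solver.Ring.NaturalCoefficients.Default commutativeSemiring
    using (solve; _:=_; _:+_; _:*_)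

  twin-identity : ∀ αa αb βa βb w Y P₀ N₀ P₁ N₁ →
    ((βb * (βa * w)) * P₀ * N₀ + (αb * (βa * w)) * P₁ * N₁) +
    ((βb * (αa * w)) * P₁ * N₁ + (αb * (αa * w)) * P₁ * (Y * N₁))
    ≈ ((βa * βb) * w) * P₀ * N₀ + ((αa * βb + αa * αb * Y + βa * αb) * w) * P₁ * N₁
  twin-identity = solve 10 (λ αa αb βa βb w Y P₀ N₀ P₁ N₁ →
    ((βb :* (βa :* w)) :* P₀ :* N₀ :+ (αb :* (βa :* w)) :* P₁ :* N₁) :+
    ((βb :* (αa :* w)) :* P₁ :* N₁ :+ (αb :* (αa :* w)) :* P₁ :* (Y :* N₁))
    := ((βa :* βb) :* w) :* P₀ :* N₀ :+ ((αa :* βb :+ αa :* αb :* Y :+ βa :* αb) :* w) :* P₁ :* N₁) ≈-refl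

  module _ (x y : Carrier) {m} (G : Graph (suc (suc m))) (α β : Fin (suc (suc m)) → Carrier)
           (a b : Fin (suc (suc m))) (tw : IdenticalTwins G a b) where

    a≢b : a ≢ b
    a≢b = proj₁ tw

    b≢a : b ≢ a
    b≢a e = proj₁ tw (≡.sym e)

    a′ : Fin (suc m)
    a′ = punchOut b≢a

    punchIn-a′ : punchIn b a′ ≡ a
    punchIn-a′ = punchIn-punchOut b≢a

    G′ : Graph (suc m)
    G′ = delete G b

    A : Carrier
    A = α a * β b + α a * α b * (y - 1#) + β a * α b

    α′ β′ : Fin (suc m) → Carrier
    α′ = setAt (λ i → α (punchIn b i)) a′ A
    β′ = setAt (λ i → β (punchIn b i)) a′ (β a * β b)

    term : ∀ {n} → Graph n → (Fin n → Carrier) → (Fin n → Carrier) → Subset n → Carrier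
    term H γ δ S = weight γ δ S * pow (x - 1#) (r H S) * pow (y - 1#) (nul H S)

    term-≈ : ∀ {n} (H : Graph n) γ δ S {w ρ ν} → weight γ δ S ≈ w → r H S ≡ ρ → nul H S ≡ ν →
             term H γ δ S ≈ w * pow (x - 1#) ρ * pow (y - 1#) ν
    term-≈ H γ δ S w≈ ≡.refl ≡.refl = *-congʳ (*-congʳ w≈)

    -- Sᵃ S s ⊆ V(G′) and Sᵃᵇ S s t ⊆ V(G) extend S ⊆ V(G) ∖ {a, b} by a ↦ s and b ↦ t.
    Sᵃ : Subset m → Bool → Subset (suc m)
    Sᵃ S s = insertAt S a′ s

    Sᵃᵇ : Subset m → Bool → Bool → Subset (suc (suc m))
    Sᵃᵇ S s t = insertAt (Sᵃ S s) b t

    mem-Sᵃᵇ-a : ∀ S s t → mem (Sᵃᵇ S s t) a ≡ s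
    mem-Sᵃᵇ-a S s t = ≡.trans (cong (mem (Sᵃᵇ S s t)) (≡.sym punchIn-a′))
                              (≡.trans (insertAt-punchIn (Sᵃ S s) b t a′) (insertAt-lookup S a′ s))

    rows : ∀ j → adj G a j ≡ adj G b j
    rows = twins⇒equal-rows G tw

    module DropB = Duplicate (adj G) (adj-sym G) a≢b rows
    module DropA = Duplicate (adj G) (adj-sym G) b≢a (≡.sym ∘ rows)

    r-b∉ : ∀ S s → r G (Sᵃᵇ S s outside) ≡ r G′ (Sᵃ S s)
    r-b∉ S s = r-delete G b (Sᵃ S s)

    nul-b∉ : ∀ S s → nul G (Sᵃᵇ S s outside) ≡ nul G′ (Sᵃ S s)
    nul-b∉ S s = nul-≡ G G′ (Sᵃᵇ S s outside) (Sᵃ S s) (∣insertAt∣ (Sᵃ S s) b outside) (r-b∉ S s)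

    r-ab∈ : ∀ S → r G (Sᵃᵇ S inside inside) ≡ r G′ (Sᵃ S inside)
    r-ab∈ S = ≡.trans
      (DropB.rankOn-duplicate (Sᵃᵇ S inside inside) (Sᵃᵇ S inside outside)
         (from T-≡ (mem-Sᵃᵇ-a S inside inside)) (insertAt-lookup (Sᵃ S inside) b outside)
         (λ j → mem-insertAt-≢ (Sᵃ S inside) b outside inside))
      (r-b∉ S inside)

    nul-ab∈ : ∀ S → nul G (Sᵃᵇ S inside inside) ≡ suc (nul G′ (Sᵃ S inside))
    nul-ab∈ S =
      nul-suc G G′ (Sᵃᵇ S inside inside) (Sᵃ S inside) (∣insertAt∣ (Sᵃ S inside) b inside) (r-ab∈ S)

    r-a∉b∈ : ∀ S → r G (Sᵃᵇ S outside inside) ≡ r G′ (Sᵃ S inside)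
    r-a∉b∈ S = ≡.trans
      (≡.sym (DropA.rankOn-duplicate (Sᵃᵇ S inside inside) (Sᵃᵇ S outside inside)
         (from T-≡ (insertAt-lookup (Sᵃ S inside) b inside)) (mem-Sᵃᵇ-a S outside inside)
         (λ j j≢a → insertAt-agree {V = Sᵃ S outside} {Sᵃ S inside}
                      (λ _ → mem-insertAt-≢ S a′ outside inside) b inside j (j≢a ∘ flip ≡.trans punchIn-a′))))
      (r-ab∈ S)

    nul-a∉b∈ : ∀ S → nul G (Sᵃᵇ S outside inside) ≡ nul G′ (Sᵃ S inside)
    nul-a∉b∈ S = nul-≡ G G′ (Sᵃᵇ S outside inside) (Sᵃ S inside) ∣Sᵃᵇ∣≡∣Sᵃ∣ (r-a∉b∈ S)
      where
      ∣Sᵃᵇ∣≡∣Sᵃ∣ : ∣ Sᵃᵇ S outside inside ∣ ≡ ∣ Sᵃ S inside ∣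
      ∣Sᵃᵇ∣≡∣Sᵃ∣ = ≡.trans (∣insertAt∣ (Sᵃ S outside) b inside)
                    (≡.trans (cong suc (∣insertAt∣ S a′ outside)) (≡.sym (∣insertAt∣ S a′ inside)))

    w : Subset m → Carrier
    w = weight (α ∘ punchIn b ∘ punchIn a′) (β ∘ punchIn b ∘ punchIn a′)

    weight-Sᵃᵇ : ∀ S s t →
      weight α β (Sᵃᵇ S s t) ≈ (if t then α b else β b) * ((if s then α a else β a) * w S)
    weight-Sᵃᵇ S s t = begin
      weight α β (Sᵃᵇ S s t)
        ≈⟨ weight-insertAt α β (Sᵃ S s) b t ⟩
      (if t then α b else β b) * weight (α ∘ punchIn b) (β ∘ punchIn b) (Sᵃ S s)
        ≈⟨ *-congˡ (weight-insertAt (α ∘ punchIn b) (β ∘ punchIn b) S a′ s) ⟩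
      (if t then α b else β b) * ((if s then α (punchIn b a′) else β (punchIn b a′)) * w S)
        ≡⟨ cong (λ k → (if t then α b else β b) * ((if s then α k else β k) * w S)) punchIn-a′ ⟩
      (if t then α b else β b) * ((if s then α a else β a) * w S)
        ∎

    weight-Sᵃ : ∀ S s → weight α′ β′ (Sᵃ S s) ≈ (if s then A else β a * β b) * w S
    weight-Sᵃ S s = begin
      weight α′ β′ (Sᵃ S s)
        ≈⟨ weight-insertAt α′ β′ S a′ s ⟩
      (if s then α′ a′ else β′ a′) * weight (α′ ∘ punchIn a′) (β′ ∘ punchIn a′) S
        ≡⟨ cong₂ _*_ (cong₂ (if s then_else_) (setAt-same α∘punchIn a′ A) (setAt-same β∘punchIn a′ (β a * β b)))
                     (weight-cong (setAt-punchIn α∘punchIn a′ A) (setAt-punchIn β∘punchIn a′ (β a * β b)) S) ⟩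
      (if s then A else β a * β b) * w S
        ∎
      where
      α∘punchIn β∘punchIn : Fin (suc m) → Carrier
      α∘punchIn i = α (punchIn b i)
      β∘punchIn i = β (punchIn b i)

    terms-Sᵃᵇ≈terms-Sᵃ : ∀ S →
      (term G α β (Sᵃᵇ S outside outside) + term G α β (Sᵃᵇ S outside inside)) +
      (term G α β (Sᵃᵇ S inside outside) + term G α β (Sᵃᵇ S inside inside))
      ≈ term G′ α′ β′ (Sᵃ S outside) + term G′ α′ β′ (Sᵃ S inside)
    terms-Sᵃᵇ≈terms-Sᵃ S = begin
      (term G α β (Sᵃᵇ S outside outside) + term G α β (Sᵃᵇ S outside inside)) +
      (term G α β (Sᵃᵇ S inside outside) + term G α β (Sᵃᵇ S inside inside))
        ≈⟨ +-cong (+-cong (term-≈ G α β (Sᵃᵇ S outside outside) (weight-Sᵃᵇ S outside outside) (r-b∉ S outside) (nul-b∉ S outside))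
                          (term-≈ G α β (Sᵃᵇ S outside inside) (weight-Sᵃᵇ S outside inside) (r-a∉b∈ S) (nul-a∉b∈ S)))
                  (+-cong (term-≈ G α β (Sᵃᵇ S inside outside) (weight-Sᵃᵇ S inside outside) (r-b∉ S inside) (nul-b∉ S inside))
                          (term-≈ G α β (Sᵃᵇ S inside inside) (weight-Sᵃᵇ S inside inside) (r-ab∈ S) (nul-ab∈ S))) ⟩
      ((β b * (β a * w S)) * P₀ * N₀ + (α b * (β a * w S)) * P₁ * N₁) +
      ((β b * (α a * w S)) * P₁ * N₁ + (α b * (α a * w S)) * P₁ * ((y - 1#) * N₁))
        ≈⟨ twin-identity (α a) (α b) (β a) (β b) (w S) (y - 1#) P₀ N₀ P₁ N₁ ⟩
      ((β a * β b) * w S) * P₀ * N₀ + (A * w S) * P₁ * N₁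
        ≈⟨ +-cong (term-≈ G′ α′ β′ (Sᵃ S outside) (weight-Sᵃ S outside) ≡.refl ≡.refl)
                  (term-≈ G′ α′ β′ (Sᵃ S inside) (weight-Sᵃ S inside) ≡.refl ≡.refl) ⟨
      term G′ α′ β′ (Sᵃ S outside) + term G′ α′ β′ (Sᵃ S inside)
        ∎
      where
      P₀ = pow (x - 1#) (r G′ (Sᵃ S outside))
      N₀ = pow (y - 1#) (nul G′ (Sᵃ S outside))
      P₁ = pow (x - 1#) (r G′ (Sᵃ S inside))
      N₁ = pow (y - 1#) (nul G′ (Sᵃ S inside))

    q-twins : q x y G α β ≈ q x y G′ α′ β′
    q-twins = begin
      ∑ₛ (suc (suc m)) (term G α β)
        ≈⟨ ∑ₛ-insertAt b (term G α β) ⟩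
      ∑ₛ (suc m) (λ V → term G α β (insertAt V b outside) + term G α β (insertAt V b inside))
        ≈⟨ ∑ₛ-insertAt a′ _ ⟩
      ∑ₛ m (λ S → (term G α β (Sᵃᵇ S outside outside) + term G α β (Sᵃᵇ S outside inside)) +
                  (term G α β (Sᵃᵇ S inside outside) + term G α β (Sᵃᵇ S inside inside)))
        ≈⟨ listSum-cong (subsets m) terms-Sᵃᵇ≈terms-Sᵃ ⟩
      ∑ₛ m (λ S → term G′ α′ β′ (Sᵃ S outside) + term G′ α′ β′ (Sᵃ S inside))
        ≈⟨ ∑ₛ-insertAt a′ (term G′ α′ β′) ⟨
      ∑ₛ (suc m) (term G′ α′ β′)
        ∎

theorem3 : ∀ {c ℓ : Level} (R : CommutativeRing c ℓ) →
  let open CommutativeRing R in let open Interlace R in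
  (x y : Carrier) (n : ℕ) (G : Graph (suc n)) (α β : Fin (suc n) → Carrier)
  (a b : Fin (suc n)) (tw : IdenticalTwins G a b) →
  let a' = punchOut {i = b} {j = a} (λ e → proj₁ tw (≡-sym e))
      α' = setAt (λ i → α (punchIn b i)) a'
             (α a * β b + α a * α b * (y - 1#) + β a * α b)
      β' = setAt (λ i → β (punchIn b i)) a' (β a * β b)
  in q x y G α β ≈ q x y (delete G b) α' β'
theorem3 R x y zero    G α β zero zero tw = ⊥-elim (proj₁ tw refl)
theorem3 R x y (suc m) G α β a b tw = TwinReduction.q-twins R x y G α β a b tw
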